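{- Let $n,m\ge1$, $R\le D_4$ with $f\in R$, and $T$ a set of tile designs for $R$. Let $\mathrm{Fix}^{\mathrm{cyl}}_{f}(n,m)=\sum_{a\in\mathbb{Z}/n\mathbb{Z}}|X^{(a,f)}|$, where $X^{(a,f)}$ is the set of tilings of the $n\times m$ cylinder fixed by $(a,f)$. Then $\mathrm{Fix}^{\mathrm{cyl}}_{f}(n,m)=n\left(\tfrac12 t_{\mathrm{id}}^{nm/2}+\tfrac12 t_{\mathrm{id}}^{(nm-2m)/2}t_f^{2m}\right)$ if $n$ is even, and $\mathrm{Fix}^{\mathrm{cyl}}_{f}(n,m)=n\,t_{\mathrm{id}}^{(nm-m)/2}t_f^{m}$ if $n$ is odd.
   Context: Cells: $\mathbb{Z}/n\mathbb{Z}\times\mathbb{Z}/m\mathbb{Z}$. $D_4=\langle r^2,f\mid (r^2)^2=f^2=\mathrm{id}\rangle$ acts on cells on the right by $(x,y)\cdot f=(n-1-x,y)$, $(x,y)\cdot r^2=(n-1-x,m-1-y)$. For $a\in\mathbb{Z}/n\mathbb{Z}$ and $g\in R$, $(x,y)\cdot(a,g)=(x+a,y)\cdot g$; so $(x,y)\cdot(a,f)=(-1-x-a,y)$. A set of tile designs for $R$ is a finite set $T$ with a right $R$-action; $t_g=|\{d\in T:d\cdot g=d\}|$. A tiling is a map $\tau$ from cells to $T$; $\tau$ is fixed by $(a,g)$ if $\tau(c\cdot(a,g))=\tau(c)\cdot g$ for all cells $c$. -}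

module Defs where

open import Data.Nat using (ℕ; zero; suc; _+_; _*_; _∸_; NonZero)
open import Data.Nat.DivMod using (_mod_)
open import Data.Bool using (Bool; true; false; T)
open import Data.Fin using (Fin; toℕ)
open import Data.Fin.Properties using (_≟_)
open import Data.Vec using (Vec; lookup)
open import Data.List using (List; length; filter; map; allFin)
open import Data.Nat.ListAction using (sum)
open import Data.Refinement using (Refinement)
open import Relation.Binary.PropositionalEquality using (_≡_)
open import Level using (0ℓ)

-- The group ⟨r², f⟩ ≤ D₄ : Klein four-group {id, r², f, r²f}.
data V4 : Set where
  e r2 f r2f : V4

_·_ : V4 → V4 → V4
e · h = h
g · e = g
r2 · r2 = e
r2 · f = r2f
r2 · r2f = f
f · r2 = r2f
f · f = e
f · r2f = r2
r2f · r2 = f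
r2f · f = r2
r2f · r2f = e

-- A subgroup R ≤ ⟨r², f⟩, given by its (boolean) membership predicate.
-- (Every element is self-inverse, so closure under inverses is automatic.)
record Subgroup : Set where
  field
    mem     : V4 → Bool
    has-e   : T (mem e)
    closed  : ∀ g h → T (mem g) → T (mem h) → T (mem (g · h))

record TileDesigns (R : Subgroup) (k : ℕ) : Set where
  open Subgroup R
  field
    act     : Fin k → (g : V4) → T (mem g) → Fin k
    act-id  : ∀ d (p : T (mem e)) → act d e p ≡ d
    act-∙   : ∀ d g h (p : T (mem g)) (q : T (mem h)) (r : T (mem (g · h))) →
              act (act d g p) h q ≡ act d (g · h) r

-- t_f = |{d ∈ T : d · f = d}|  (t_id = k).
t-f : ∀ {R k} → TileDesigns R k → T (Subgroup.mem R f) → ℕ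
t-f {k = k} TD fR =
  length (filter (λ d → TileDesigns.act TD d f fR ≟ d) (allFin k))

-- x ↦ -1 - x - a  in ℤ/nℤ  (first coordinate of (x,y)·(a,f)).
reflectA : (n : ℕ) → .{{NonZero n}} → Fin n → Fin n → Fin n
reflectA n a x = ((n + n) ∸ (1 + toℕ x + toℕ a)) mod n

Tiling : ℕ → ℕ → ℕ → Set
Tiling n m k = Vec (Vec (Fin k) m) n

FixedBy : ∀ {R k} (n m : ℕ) .{{_ : NonZero n}} → TileDesigns R k →
          T (Subgroup.mem R f) → Fin n → Tiling n m k → Set
FixedBy n m TD fR a τ =
  ∀ x y → lookup (lookup τ (reflectA n a x)) y
          ≡ TileDesigns.act TD (lookup (lookup τ x) y) f fR

X : ∀ {R k} (n m : ℕ) .{{_ : NonZero n}} → TileDesigns R k →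
    T (Subgroup.mem R f) → Fin n → Set
X {k = k} n m TD fR a = Refinement {0ℓ} {0ℓ} (Tiling n m k) (FixedBy n m TD fR a)

sumFin : (n : ℕ) → (Fin n → ℕ) → ℕ
sumFin n c = sum (map c (allFin n))

-- A tiling fixed by (a, f) is determined column by column, and a column v : ℤ/nℤ → T
-- must satisfy v(−1−x−a) = v(x)·f.  This reflection of ℤ/nℤ maps each of the blocks
-- [0, n−a) and [n−a, n) onto itself, reversing it, so a fixed column is a pair of
-- "f-palindromes" of lengths n−a and a.  An f-palindrome of length l is free in its first
-- ⌊l/2⌋ entries and has an f-fixed middle entry when l is odd, so there are
-- t_id^⌊l/2⌋ · t_f^(l mod 2) of them.  Hence |X^(a,f)| depends only on the parities of
-- n and a, and summing over a ∈ ℤ/nℤ gives the formula.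

module Submission where

open import Defs
open import Data.Nat using (ℕ; _+_; _*_; _∸_; _^_; _/_; NonZero)
open import Data.Nat.Divisibility using (_∣_; _∤_)
open import Data.Bool using (T)
open import Data.Fin using (Fin)
open import Data.Product using (_×_)
open import Function.Bundles using (_↔_)
open import Relation.Binary.PropositionalEquality using (_≡_)

open import Data.Nat using (zero; suc; _<_; z≤n; s≤s)
open import Data.Nat.Properties
open import Data.Nat.DivMod using (_%_; %-congˡ; %-remove-+ˡ; m<n⇒m%n≡m; m*n/n≡m)
open import Data.Nat.Divisibility using (divides; ∣-refl)
open import Data.Nat.Tactic.RingSolver using (solve-∀)
open import Data.Nat.ListAction using (sum)
open import Data.Fin as Fin using (toℕ; fromℕ; inject₁; opposite; _↑ˡ_; _↑ʳ_; splitAt; join)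
open import Data.Fin.Properties as FinP
  using (toℕ-injective; toℕ-↑ˡ; toℕ-↑ʳ; toℕ<n; opposite-prop; join-splitAt; toℕ-fromℕ<; *↔×)
open import Data.Fin.Relation.Unary.Top using (view; ‵fromℕ; ‵inject₁)
open import Data.Fin.Permutation using (↔⇒≡)
open import Data.Vec as Vec using (Vec; []; _∷_; lookup; tabulate; _∷ʳ_; _++_)
open import Data.Vec.Properties using (lookup∘tabulate; tabulate∘lookup; tabulate-cong; lookup-++ˡ; lookup-++ʳ)
open import Data.List as List using (applyUpTo; filter; length)
open import Data.List.Properties using (map-tabulate)
open import Data.Refinement as Refinement using (Refinement; _,_; value)
open import Data.Refinement.Properties using (value-injective)
open import Data.Irrelevant using ([_])
open import Data.Product using (_,_; ∃)
open import Data.Product.Function.NonDependent.Propositional using (_×-↔_)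
open import Data.Sum using (_⊎_; inj₁; inj₂; [_,_])
open import Data.Empty using (⊥-elim; ⊥-elim-irr)
open import Function using (_∘_; id)
open import Function.Bundles using (Inverse; mk↔ₛ′)
open import Function.Properties.Inverse using (↔-refl; ↔-trans; ↔-sym)
open import Relation.Nullary using (yes; no)
open import Relation.Nullary.Decidable using (recompute)
open import Relation.Unary using (Decidable)
open import Relation.Binary.Definitions using (DecidableEquality)
open import Relation.Binary.PropositionalEquality using (refl; sym; trans; cong; cong₂; subst; module ≡-Reasoning)

private
  variable
    A B : Set
    m n : ℕ

lookup-extensionality : {u v : Vec A n} → (∀ i → lookup u i ≡ lookup v i) → u ≡ v
lookup-extensionality {u = u} {v} eq =
  trans (sym (tabulate∘lookup u)) (trans (tabulate-cong eq) (tabulate∘lookup v))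

↑-cases : ∀ {u r} {P : Fin (u + r) → Set} →
          (∀ i → P (i ↑ˡ r)) → (∀ j → P (u ↑ʳ j)) → ∀ x → P x
↑-cases {u} {r} {P} left right x =
  subst P (join-splitAt u r x) ([_,_] {C = P ∘ join u r} left right (splitAt u x))

opposite-inject₁ : (i : Fin n) → opposite {suc n} (inject₁ i) ≡ Fin.suc (opposite i)
opposite-inject₁ Fin.zero    = refl
opposite-inject₁ (Fin.suc i) = cong inject₁ (opposite-inject₁ i)

opposite-fromℕ : ∀ n → opposite (fromℕ n) ≡ Fin.zero
opposite-fromℕ zero    = refl
opposite-fromℕ (suc n) = cong inject₁ (opposite-fromℕ n)

lookup-∷ʳ-inject₁ : ∀ (w : Vec A n) y i → lookup (w ∷ʳ y) (inject₁ i) ≡ lookup w i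
lookup-∷ʳ-inject₁ (x ∷ w) y Fin.zero    = refl
lookup-∷ʳ-inject₁ (x ∷ w) y (Fin.suc i) = lookup-∷ʳ-inject₁ w y i

lookup-∷ʳ-fromℕ : ∀ (w : Vec A n) y → lookup (w ∷ʳ y) (fromℕ n) ≡ y
lookup-∷ʳ-fromℕ []      y = refl
lookup-∷ʳ-fromℕ (x ∷ w) y = lookup-∷ʳ-fromℕ w y

Vec↔Fin^ : ∀ {a} m → A ↔ Fin a → Vec A m ↔ Fin (a ^ m)
Vec↔Fin^ zero    _   = mk↔ₛ′ (λ _ → Fin.zero) (λ _ → [])
  (λ { Fin.zero → refl ; (Fin.suc ()) }) (λ { [] → refl })
Vec↔Fin^ {A} (suc m) A↔a = ↔-trans uncons (↔-trans (A↔a ×-↔ Vec↔Fin^ m A↔a) (↔-sym *↔×))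
  where
  uncons : Vec A (suc m) ↔ (A × Vec A m)
  uncons = mk↔ₛ′ (λ { (x ∷ xs) → x , xs }) (λ (x , xs) → x ∷ xs)
    (λ _ → refl) (λ { (x ∷ xs) → refl })

filter-tabulate↔ : ∀ {P : B → Set} (P? : Decidable P) n (g : Fin n → B) →
                   Refinement (Fin n) (P ∘ g) ↔ Fin (length (filter P? (List.tabulate g)))
filter-tabulate↔ P? zero g = mk↔ₛ′ (λ { (() , _) }) (λ ()) (λ ()) (λ { (() , _) })
filter-tabulate↔ {P = P} P? (suc n) g with P? (g Fin.zero) | filter-tabulate↔ P? n (g ∘ Fin.suc)
... | yes p | I = mk↔ₛ′ to from to∘from from∘to
  where
  module I = Inverse I
  to : Refinement (Fin (suc n)) (P ∘ g) → Fin (suc _)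
  to (Fin.zero  , _) = Fin.zero
  to (Fin.suc i , q) = Fin.suc (I.to (i , q))
  from : Fin (suc _) → Refinement (Fin (suc n)) (P ∘ g)
  from Fin.zero    = Fin.zero , [ p ]
  from (Fin.suc j) = Refinement.map Fin.suc id (I.from j)
  to∘from : ∀ j → to (from j) ≡ j
  to∘from Fin.zero    = refl
  to∘from (Fin.suc j) = cong Fin.suc (I.strictlyInverseˡ j)
  from∘to : ∀ x → from (to x) ≡ x
  from∘to (Fin.zero  , _) = refl
  from∘to (Fin.suc i , q) = cong (Refinement.map Fin.suc id) (I.strictlyInverseʳ (i , q))
... | no ¬p | I = mk↔ₛ′ to (Refinement.map Fin.suc id ∘ I.from) I.strictlyInverseˡ from∘to
  where
  module I = Inverse I
  to : Refinement (Fin (suc n)) (P ∘ g) → Fin _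
  to (Fin.zero  , [ q ]) = ⊥-elim-irr (¬p q)
  to (Fin.suc i , q)     = I.to (i , q)
  from∘to : ∀ x → Refinement.map Fin.suc id (I.from (to x)) ≡ x
  from∘to (Fin.zero  , [ q ]) = ⊥-elim-irr (¬p q)
  from∘to (Fin.suc i , q)     = cong (Refinement.map Fin.suc id) (I.strictlyInverseʳ (i , q))

applyUpTo-cong : ∀ {F G : ℕ → A} n → (∀ a → a < n → F a ≡ G a) → applyUpTo F n ≡ applyUpTo G n
applyUpTo-cong zero    _   = refl
applyUpTo-cong (suc n) F≡G = cong₂ List._∷_ (F≡G 0 (s≤s z≤n)) (applyUpTo-cong n (λ a a< → F≡G (suc a) (s≤s a<)))

tabulate≡applyUpTo : ∀ n {h : Fin n → A} {F : ℕ → A} → (∀ i → h i ≡ F (toℕ i)) →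
                     List.tabulate h ≡ applyUpTo F n
tabulate≡applyUpTo zero    _   = refl
tabulate≡applyUpTo (suc n) h≡F = cong₂ List._∷_ (h≡F Fin.zero) (tabulate≡applyUpTo n (h≡F ∘ Fin.suc))

sum-applyUpTo-periodic : ∀ h r {n} (F : ℕ → ℕ) → n ≡ h * 2 + r → (∀ a → 2 + a < n → F (2 + a) ≡ F a) →
                         sum (applyUpTo F n) ≡ h * (F 0 + F 1) + sum (applyUpTo F r)
sum-applyUpTo-periodic zero    r F refl _        = refl
sum-applyUpTo-periodic (suc h) r F refl periodic = begin
  F 0 + (F 1 + sum (applyUpTo (F ∘ suc ∘ suc) (h * 2 + r)))
    ≡⟨ cong (λ xs → F 0 + (F 1 + sum xs)) (applyUpTo-cong (h * 2 + r) (λ a a< → periodic a (s≤s (s≤s a<)))) ⟩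
  F 0 + (F 1 + sum (applyUpTo F (h * 2 + r)))
    ≡⟨ cong (λ s → F 0 + (F 1 + s)) (sum-applyUpTo-periodic h r F refl λ a a< → periodic a (≤-trans a< (m≤n+m _ 2))) ⟩
  F 0 + (F 1 + (h * (F 0 + F 1) + sum (applyUpTo F r)))
    ≡⟨ regroup (F 0) (F 1) h (sum (applyUpTo F r)) ⟩
  suc h * (F 0 + F 1) + sum (applyUpTo F r) ∎
  where
  open ≡-Reasoning
  regroup : ∀ x y h s → x + (y + (h * (x + y) + s)) ≡ (1 + h) * (x + y) + s
  regroup = solve-∀

parity : ∀ n → (∃ λ h → n ≡ h * 2) ⊎ (∃ λ h → n ≡ suc (h * 2))
parity zero = inj₁ (0 , refl)
parity (suc n) with parity n
... | inj₁ (h , n≡) = inj₂ (h , cong suc n≡)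
... | inj₂ (h , n≡) = inj₁ (suc h , cong suc n≡)

^-distribʳ-* : ∀ a b m → (a * b) ^ m ≡ a ^ m * b ^ m
^-distribʳ-* a b zero    = refl
^-distribʳ-* a b (suc m) = trans (cong ((a * b) *_) (^-distribʳ-* a b m)) (interchange a b (a ^ m) (b ^ m))
  where
  interchange : ∀ a b c d → (a * b) * (c * d) ≡ (a * c) * (b * d)
  interchange = solve-∀

h*2*m/2≡h*m : ∀ h m → h * 2 * m / 2 ≡ h * m
h*2*m/2≡h*m h m = trans (cong (_/ 2) (reorder h m)) (m*n/n≡m (h * m) 2)
  where
  reorder : ∀ h m → h * 2 * m ≡ h * m * 2
  reorder = solve-∀

[1+h]*2*m∸2*m/2≡h*m : ∀ h m → (suc h * 2 * m ∸ 2 * m) / 2 ≡ h * m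
[1+h]*2*m∸2*m/2≡h*m h m = begin
  (suc h * 2 * m ∸ 2 * m) / 2         ≡⟨ cong (λ x → (x ∸ 2 * m) / 2) (expand h m) ⟩
  (h * 2 * m + 2 * m ∸ 2 * m) / 2     ≡⟨ cong (_/ 2) (m+n∸n≡m (h * 2 * m) (2 * m)) ⟩
  h * 2 * m / 2                       ≡⟨ h*2*m/2≡h*m h m ⟩
  h * m                               ∎
  where
  open ≡-Reasoning
  expand : ∀ h m → (1 + h) * 2 * m ≡ h * 2 * m + 2 * m
  expand = solve-∀

[1+h*2]*m∸m/2≡h*m : ∀ h m → (suc (h * 2) * m ∸ m) / 2 ≡ h * m
[1+h*2]*m∸m/2≡h*m h m = trans (cong (_/ 2) (m+n∸m≡n m (h * 2 * m))) (h*2*m/2≡h*m h m)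

reflect-left : ∀ n .{{_ : NonZero n}} u r i → n ≡ u + r → i < u →
               (n + n ∸ (1 + i + r)) % n ≡ u ∸ suc i
reflect-left n u r i n≡u+r i<u = begin
  (n + n ∸ (1 + i + r)) % n                 ≡⟨ %-congˡ (cong (_∸ (1 + i + r)) n+n≡) ⟩
  ((n + v) + (1 + i + r) ∸ (1 + i + r)) % n ≡⟨ %-congˡ (m+n∸n≡m (n + v) (1 + i + r)) ⟩
  (n + v) % n                               ≡⟨ %-remove-+ˡ v ∣-refl ⟩
  v % n                                     ≡⟨ m<n⇒m%n≡m v<n ⟩
  v                                         ∎
  where
  open ≡-Reasoning
  v : ℕ
  v = u ∸ suc i
  n≡ : n ≡ (1 + i + v) + r
  n≡ = trans n≡u+r (cong (_+ r) (sym (m+[n∸m]≡n i<u)))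
  shuffle : ∀ n i v r → n + ((1 + i + v) + r) ≡ (n + v) + (1 + i + r)
  shuffle = solve-∀
  n+n≡ : n + n ≡ (n + v) + (1 + i + r)
  n+n≡ = trans (cong (n +_) n≡) (shuffle n i v r)
  v<n : v < n
  v<n = subst (v <_) (sym n≡) (s≤s (≤-trans (m≤n+m v i) (m≤m+n (i + v) r)))

reflect-right : ∀ n .{{_ : NonZero n}} u r j → n ≡ u + r → j < r →
                (n + n ∸ (1 + (u + j) + r)) % n ≡ u + (r ∸ suc j)
reflect-right n u r j n≡u+r j<r = begin
  (n + n ∸ (1 + (u + j) + r)) % n                       ≡⟨ %-congˡ (cong (_∸ (1 + (u + j) + r)) n+n≡) ⟩
  ((u + w) + (1 + (u + j) + r) ∸ (1 + (u + j) + r)) % n ≡⟨ %-congˡ (m+n∸n≡m (u + w) (1 + (u + j) + r)) ⟩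
  (u + w) % n                                           ≡⟨ m<n⇒m%n≡m u+w<n ⟩
  u + w                                                 ∎
  where
  open ≡-Reasoning
  w : ℕ
  w = r ∸ suc j
  n≡ : n ≡ u + (1 + j + w)
  n≡ = trans n≡u+r (cong (u +_) (sym (m+[n∸m]≡n j<r)))
  shuffle : ∀ u j w r → (u + (1 + j + w)) + (u + r) ≡ (u + w) + (1 + (u + j) + r)
  shuffle = solve-∀
  n+n≡ : n + n ≡ (u + w) + (1 + (u + j) + r)
  n+n≡ = trans (cong₂ _+_ n≡ n≡u+r) (shuffle u j w r)
  u+w<n : u + w < n
  u+w<n = subst (u + w <_) (sym n≡) (+-monoʳ-< u (s≤s (m≤n+m w j)))

module _ n .{{_ : NonZero n}} (a : Fin n) where

  private
    n≡[n∸a]+a : n ≡ (n ∸ toℕ a) + toℕ a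
    n≡[n∸a]+a = sym (m∸n+n≡m (<⇒≤ (toℕ<n a)))

  toℕ-reflectA-left : ∀ x i → toℕ x ≡ i → i < n ∸ toℕ a → toℕ (reflectA n a x) ≡ (n ∸ toℕ a) ∸ suc i
  toℕ-reflectA-left x i refl i< = trans (toℕ-fromℕ< _) (reflect-left n (n ∸ toℕ a) (toℕ a) i n≡[n∸a]+a i<)

  toℕ-reflectA-right : ∀ x j → toℕ x ≡ (n ∸ toℕ a) + j → j < toℕ a →
                       toℕ (reflectA n a x) ≡ (n ∸ toℕ a) + (toℕ a ∸ suc j)
  toℕ-reflectA-right x j x≡ j< = begin
    toℕ (reflectA n a x)                                      ≡⟨ toℕ-fromℕ< _ ⟩
    (n + n ∸ (1 + toℕ x + toℕ a)) % n                         ≡⟨ cong (λ z → (n + n ∸ (1 + z + toℕ a)) % n) x≡ ⟩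
    (n + n ∸ (1 + ((n ∸ toℕ a) + j) + toℕ a)) % n             ≡⟨ reflect-right n (n ∸ toℕ a) (toℕ a) j n≡[n∸a]+a j< ⟩
    (n ∸ toℕ a) + (toℕ a ∸ suc j)                             ∎
    where open ≡-Reasoning

palindromeCount : ℕ → ℕ → ℕ → ℕ
palindromeCount k t zero          = 1
palindromeCount k t (suc zero)    = t
palindromeCount k t (suc (suc l)) = k * palindromeCount k t l

-- Decidable equality is only used to recover the irrelevant proofs stored in refinements.
module Equivariance {A : Set} (_≟_ : DecidableEquality A) (φ : A → A) where

  Equivariant : (Fin n → Fin n) → Vec A n → Set
  Equivariant σ v = ∀ x → lookup v (σ x) ≡ φ (lookup v x)

  Equivariants : (Fin n → Fin n) → Set
  Equivariants {n} σ = Refinement (Vec A n) (Equivariant σ)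

  equivariant : {σ : Fin n → Fin n} (v : Equivariants σ) → Equivariant σ (value v)
  equivariant {σ = σ} (v , [ p ]) x = recompute (lookup v (σ x) ≟ φ (lookup v x)) (p x)

  Palindromes : ℕ → Set
  Palindromes n = Equivariants (opposite {n})

  Fixed : Set
  Fixed = Refinement A (λ d → φ d ≡ d)

  module _ (ι : Fin m → Fin n) (σ : Fin n → Fin n) (τ : Fin m → Fin m)
           (ι-commutes : ∀ i → σ (ι i) ≡ ι (τ i)) where

    equivariant-restrict : ∀ v → Equivariant σ v → Equivariant τ (tabulate (lookup v ∘ ι))
    equivariant-restrict v v-eq i = begin
      lookup (tabulate (lookup v ∘ ι)) (τ i) ≡⟨ lookup∘tabulate _ (τ i) ⟩
      lookup v (ι (τ i))                     ≡⟨ cong (lookup v) (ι-commutes i) ⟨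
      lookup v (σ (ι i))                     ≡⟨ v-eq (ι i) ⟩
      φ (lookup v (ι i))                     ≡⟨ cong φ (lookup∘tabulate _ i) ⟨
      φ (lookup (tabulate (lookup v ∘ ι)) i) ∎
      where open ≡-Reasoning

    equivariant-along : ∀ v w → (∀ i → lookup v (ι i) ≡ lookup w i) → Equivariant τ w →
                        ∀ i → lookup v (σ (ι i)) ≡ φ (lookup v (ι i))
    equivariant-along v w v∘ι≡w w-eq i = begin
      lookup v (σ (ι i)) ≡⟨ cong (lookup v) (ι-commutes i) ⟩
      lookup v (ι (τ i)) ≡⟨ v∘ι≡w (τ i) ⟩
      lookup w (τ i)     ≡⟨ w-eq i ⟩
      φ (lookup w i)     ≡⟨ cong φ (v∘ι≡w i) ⟨
      φ (lookup v (ι i)) ∎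
      where open ≡-Reasoning

  palindromes-0↔ : Palindromes 0 ↔ Fin 1
  palindromes-0↔ = mk↔ₛ′ (λ _ → Fin.zero) (λ _ → [] , [ (λ ()) ])
    (λ { Fin.zero → refl ; (Fin.suc ()) }) (λ { ([] , _) → refl })

  palindromes-1↔ : Palindromes 1 ↔ Fixed
  palindromes-1↔ = mk↔ₛ′ to from (λ _ → refl) (λ { ((d ∷ []) , _) → refl })
    where
    to : Palindromes 1 → Fixed
    to v = lookup (value v) Fin.zero , [ sym (equivariant v Fin.zero) ]
    from : Fixed → Palindromes 1
    from (d , [ φd≡d ]) = (d ∷ []) , [ (λ { Fin.zero → sym φd≡d }) ]

  module _ (φ-involutive : ∀ d → φ (φ d) ≡ d) where

    palindromes-2+↔ : ∀ l → Palindromes (2 + l) ↔ (A × Palindromes l)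
    palindromes-2+↔ l = mk↔ₛ′ to from to∘from from∘to
      where
      ι : Fin l → Fin (2 + l)
      ι = Fin.suc ∘ inject₁

      ι-commutes : ∀ i → opposite (ι i) ≡ ι (opposite i)
      ι-commutes i = cong inject₁ (opposite-inject₁ i)

      wrap : A → Vec A l → Vec A (2 + l)
      wrap x w = x ∷ (w ∷ʳ φ x)

      wrap∘ι : ∀ x w i → lookup (wrap x w) (ι i) ≡ lookup w i
      wrap∘ι x w = lookup-∷ʳ-inject₁ w (φ x)

      wrap-palindrome : ∀ x {w} → Equivariant opposite w → Equivariant opposite (wrap x w)
      wrap-palindrome x {w} w-eq Fin.zero = lookup-∷ʳ-fromℕ w (φ x)
      wrap-palindrome x {w} w-eq (Fin.suc j) with view j
      ... | ‵fromℕ = begin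
        lookup (wrap x w) (inject₁ (opposite (fromℕ l))) ≡⟨ cong (lookup (wrap x w) ∘ inject₁) (opposite-fromℕ l) ⟩
        x                                               ≡⟨ φ-involutive x ⟨
        φ (φ x)                                         ≡⟨ cong φ (lookup-∷ʳ-fromℕ w (φ x)) ⟨
        φ (lookup (w ∷ʳ φ x) (fromℕ l))                 ∎
        where open ≡-Reasoning
      ... | ‵inject₁ i = equivariant-along ι opposite opposite ι-commutes (wrap x w) w (wrap∘ι x w) w-eq i

      to : Palindromes (2 + l) → A × Palindromes l
      to (v , [ v-eq ]) = Vec.head v , tabulate (lookup v ∘ ι) , [ equivariant-restrict ι opposite opposite ι-commutes v v-eq ]

      from : A × Palindromes l → Palindromes (2 + l)
      from (x , w , [ w-eq ]) = wrap x w , [ wrap-palindrome x w-eq ]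

      to∘from : ∀ p → to (from p) ≡ p
      to∘from (x , w , _) = cong (x ,_) (value-injective (lookup-extensionality λ i →
        trans (lookup∘tabulate _ i) (wrap∘ι x w i)))

      from∘to : ∀ v → from (to v) ≡ v
      from∘to v@(x ∷ _ , _) = value-injective (lookup-extensionality wrap-inner)
        where
        inner : Vec A l
        inner = tabulate (lookup (value v) ∘ ι)
        wrap-inner : ∀ j → lookup (wrap x inner) j ≡ lookup (value v) j
        wrap-inner Fin.zero = refl
        wrap-inner (Fin.suc j) with view j
        ... | ‵fromℕ = trans (lookup-∷ʳ-fromℕ inner (φ x)) (sym (equivariant v Fin.zero))
        ... | ‵inject₁ i = trans (wrap∘ι x inner i) (lookup∘tabulate _ i)

    palindromes↔ : ∀ {k t} → A ↔ Fin k → Fixed ↔ Fin t → ∀ l → Palindromes l ↔ Fin (palindromeCount k t l)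
    palindromes↔ _   _       zero          = palindromes-0↔
    palindromes↔ _   Fixed↔t (suc zero)    = ↔-trans palindromes-1↔ Fixed↔t
    palindromes↔ A↔k Fixed↔t (suc (suc l)) =
      ↔-trans (palindromes-2+↔ l) (↔-trans (A↔k ×-↔ palindromes↔ A↔k Fixed↔t l) (↔-sym *↔×))

  equivariants-split↔ : ∀ {N} u r → u + r ≡ N → (σ : Fin N → Fin N) →
    (∀ x i → toℕ x ≡ i → i < u → toℕ (σ x) ≡ u ∸ suc i) →
    (∀ x j → toℕ x ≡ u + j → j < r → toℕ (σ x) ≡ u + (r ∸ suc j)) →
    Equivariants σ ↔ (Palindromes u × Palindromes r)
  equivariants-split↔ u r refl σ σ-left σ-right = mk↔ₛ′ to from to∘from from∘to
    where
    σ-↑ˡ : ∀ i → σ (i ↑ˡ r) ≡ opposite i ↑ˡ r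
    σ-↑ˡ i = toℕ-injective (trans (σ-left (i ↑ˡ r) (toℕ i) (toℕ-↑ˡ i r) (toℕ<n i))
                                  (sym (trans (toℕ-↑ˡ (opposite i) r) (opposite-prop i))))

    σ-↑ʳ : ∀ j → σ (u ↑ʳ j) ≡ u ↑ʳ opposite j
    σ-↑ʳ j = toℕ-injective (trans (σ-right (u ↑ʳ j) (toℕ j) (toℕ-↑ʳ u j) (toℕ<n j))
                                  (sym (trans (toℕ-↑ʳ u (opposite j)) (cong (u +_) (opposite-prop j)))))

    left : Vec A (u + r) → Vec A u
    left v = tabulate (lookup v ∘ (_↑ˡ r))

    right : Vec A (u + r) → Vec A r
    right v = tabulate (lookup v ∘ (u ↑ʳ_))

    to : Equivariants σ → Palindromes u × Palindromes r
    to (v , [ v-eq ]) = (left v , [ equivariant-restrict (_↑ˡ r) σ opposite σ-↑ˡ v v-eq ])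
                      , (right v , [ equivariant-restrict (u ↑ʳ_) σ opposite σ-↑ʳ v v-eq ])

    ++-equivariant : ∀ a b → Equivariant opposite a → Equivariant opposite b → Equivariant σ (a ++ b)
    ++-equivariant a b a-eq b-eq = ↑-cases
      (equivariant-along (_↑ˡ r) σ opposite σ-↑ˡ (a ++ b) a (lookup-++ˡ a b) a-eq)
      (equivariant-along (u ↑ʳ_) σ opposite σ-↑ʳ (a ++ b) b (lookup-++ʳ a b) b-eq)

    from : Palindromes u × Palindromes r → Equivariants σ
    from ((a , [ a-eq ]) , (b , [ b-eq ])) = a ++ b , [ ++-equivariant a b a-eq b-eq ]

    to∘from : ∀ p → to (from p) ≡ p
    to∘from ((a , _) , (b , _)) = cong₂ _,_
      (value-injective (lookup-extensionality λ i → trans (lookup∘tabulate _ i) (lookup-++ˡ a b i)))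
      (value-injective (lookup-extensionality λ j → trans (lookup∘tabulate _ j) (lookup-++ʳ a b j)))

    from∘to : ∀ v → from (to v) ≡ v
    from∘to (v , _) = value-injective (lookup-extensionality (↑-cases
      (λ i → trans (lookup-++ˡ (left v) (right v) i) (lookup∘tabulate _ i))
      (λ j → trans (lookup-++ʳ (left v) (right v) j) (lookup∘tabulate _ j))))

  EquivariantRows : (Fin n → Fin n) → Vec (Vec A m) n → Set
  EquivariantRows σ τ = ∀ x y → lookup (lookup τ (σ x)) y ≡ φ (lookup (lookup τ x) y)

  equivariantRows↔columns : (σ : Fin n → Fin n) →
                            Refinement (Vec (Vec A m) n) (EquivariantRows σ) ↔ Vec (Equivariants σ) m
  equivariantRows↔columns {n} {m} σ = mk↔ₛ′ to from to∘from from∘to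
    where
    column : Vec (Vec A m) n → Fin m → Vec A n
    column τ y = tabulate (λ x → lookup (lookup τ x) y)

    rows : Vec (Equivariants σ) m → Vec (Vec A m) n
    rows cs = tabulate (λ x → tabulate (λ y → lookup (value (lookup cs y)) x))

    lookup-rows : ∀ cs x y → lookup (lookup (rows cs) x) y ≡ lookup (value (lookup cs y)) x
    lookup-rows cs x y = trans (cong (λ row → lookup row y) (lookup∘tabulate _ x)) (lookup∘tabulate _ y)

    to : Refinement (Vec (Vec A m) n) (EquivariantRows σ) → Vec (Equivariants σ) m
    to (τ , [ τ-eq ]) = tabulate λ y → column τ y , [ (λ x →
      trans (lookup∘tabulate _ (σ x)) (trans (τ-eq x y) (cong φ (sym (lookup∘tabulate _ x))))) ]

    from : Vec (Equivariants σ) m → Refinement (Vec (Vec A m) n) (EquivariantRows σ)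
    from cs = rows cs , [ (λ x y →
      trans (lookup-rows cs (σ x) y) (trans (equivariant (lookup cs y) x) (cong φ (sym (lookup-rows cs x y))))) ]

    to∘from : ∀ cs → to (from cs) ≡ cs
    to∘from cs = lookup-extensionality λ y → trans (lookup∘tabulate _ y)
      (value-injective (lookup-extensionality λ x → trans (lookup∘tabulate _ x) (lookup-rows cs x y)))

    from∘to : ∀ τ → from (to τ) ≡ τ
    from∘to (τ , p) = value-injective (lookup-extensionality λ x → lookup-extensionality λ y →
      trans (lookup-rows (to (τ , p)) x y)
            (trans (cong (λ c → lookup (value c) x) (lookup∘tabulate _ y)) (lookup∘tabulate _ x)))

  reflectA-equivariants↔ : ∀ n .{{_ : NonZero n}} (a : Fin n) →
                           Equivariants (reflectA n a) ↔ (Palindromes (n ∸ toℕ a) × Palindromes (toℕ a))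
  reflectA-equivariants↔ n a = equivariants-split↔ (n ∸ toℕ a) (toℕ a) (m∸n+n≡m (<⇒≤ (toℕ<n a)))
    (reflectA n a) (toℕ-reflectA-left n a) (toℕ-reflectA-right n a)

module _ (k t : ℕ) where

  palindromeCount-even : ∀ h → palindromeCount k t (h * 2) ≡ k ^ h
  palindromeCount-even zero    = refl
  palindromeCount-even (suc h) = cong (k *_) (palindromeCount-even h)

  palindromeCount-odd : ∀ h → palindromeCount k t (suc (h * 2)) ≡ k ^ h * t
  palindromeCount-odd zero    = sym (*-identityˡ t)
  palindromeCount-odd (suc h) = trans (cong (k *_) (palindromeCount-odd h)) (sym (*-assoc k (k ^ h) t))

  fixedTilingCount : ℕ → ℕ → ℕ → ℕ
  fixedTilingCount n m a = (palindromeCount k t (n ∸ a) * palindromeCount k t a) ^ m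

  fixedTilingCount-periodic : ∀ n m a → 2 + a < n → fixedTilingCount n m (2 + a) ≡ fixedTilingCount n m a
  fixedTilingCount-periodic n m a 2+a<n = cong (_^ m) (begin
    cnt w * cnt (2 + a)      ≡⟨ swap k (cnt w) (cnt a) ⟩
    cnt (2 + w) * cnt a      ≡⟨ cong (λ l → cnt l * cnt a) n∸a≡2+w ⟨
    cnt (n ∸ a) * cnt a      ∎)
    where
    open ≡-Reasoning
    cnt : ℕ → ℕ
    cnt = palindromeCount k t
    w : ℕ
    w = n ∸ (2 + a)
    swap : ∀ k x y → x * (k * y) ≡ (k * x) * y
    swap = solve-∀
    reorder : ∀ a w → 2 + a + w ≡ a + (2 + w)
    reorder = solve-∀
    n∸a≡2+w : n ∸ a ≡ 2 + w
    n∸a≡2+w = begin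
      n ∸ a               ≡⟨ cong (_∸ a) (m+[n∸m]≡n (<⇒≤ 2+a<n)) ⟨
      (2 + a + w) ∸ a     ≡⟨ cong (_∸ a) (reorder a w) ⟩
      (a + (2 + w)) ∸ a   ≡⟨ m+n∸m≡n a (2 + w) ⟩
      2 + w               ∎

  sum-fixedTilingCount-even : ∀ n m → 2 ∣ n →
    2 * sum (applyUpTo (fixedTilingCount n m) n) ≡ n * (k ^ ((n * m) / 2) + k ^ ((n * m ∸ 2 * m) / 2) * t ^ (2 * m))
  sum-fixedTilingCount-even n m (divides zero    refl) = refl
  sum-fixedTilingCount-even n m (divides (suc h) refl) = begin
    2 * sum (applyUpTo F n)
      ≡⟨ cong (2 *_) (sum-applyUpTo-periodic (suc h) 0 F (sym (+-identityʳ n)) (fixedTilingCount-periodic n m)) ⟩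
    2 * (suc h * (F 0 + F 1) + 0)
      ≡⟨ regroup (suc h) (F 0 + F 1) ⟩
    n * (F 0 + F 1)
      ≡⟨ cong (n *_) (cong₂ _+_ F0≡ F1≡) ⟩
    n * (k ^ ((n * m) / 2) + k ^ ((n * m ∸ 2 * m) / 2) * t ^ (2 * m)) ∎
    where
    open ≡-Reasoning
    F : ℕ → ℕ
    F = fixedTilingCount n m
    regroup : ∀ q x → 2 * (q * x + 0) ≡ q * 2 * x
    regroup = solve-∀
    F0≡ : F 0 ≡ k ^ ((n * m) / 2)
    F0≡ = begin
      (palindromeCount k t n * 1) ^ m ≡⟨ cong (_^ m) (trans (*-identityʳ _) (palindromeCount-even (suc h))) ⟩
      (k ^ suc h) ^ m                 ≡⟨ ^-*-assoc k (suc h) m ⟩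
      k ^ (suc h * m)                 ≡⟨ cong (k ^_) (h*2*m/2≡h*m (suc h) m) ⟨
      k ^ ((n * m) / 2)               ∎
    F1≡ : F 1 ≡ k ^ ((n * m ∸ 2 * m) / 2) * t ^ (2 * m)
    F1≡ = begin
      (palindromeCount k t (suc (h * 2)) * t) ^ m ≡⟨ cong (λ x → (x * t) ^ m) (palindromeCount-odd h) ⟩
      (k ^ h * t * t) ^ m                         ≡⟨ cong (_^ m) (*-assoc (k ^ h) t t) ⟩
      (k ^ h * (t * t)) ^ m                       ≡⟨ ^-distribʳ-* (k ^ h) (t * t) m ⟩
      (k ^ h) ^ m * (t * t) ^ m                   ≡⟨ cong₂ _*_ (^-*-assoc k h m) t²^m≡ ⟩
      k ^ (h * m) * t ^ (2 * m)                   ≡⟨ cong (λ e → k ^ e * t ^ (2 * m)) ([1+h]*2*m∸2*m/2≡h*m h m) ⟨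
      k ^ ((n * m ∸ 2 * m) / 2) * t ^ (2 * m)     ∎
      where
      t²^m≡ : (t * t) ^ m ≡ t ^ (2 * m)
      t²^m≡ = trans (cong (λ x → (t * x) ^ m) (sym (*-identityʳ t))) (^-*-assoc t 2 m)

  sum-fixedTilingCount-odd : ∀ n m → 2 ∤ n →
    sum (applyUpTo (fixedTilingCount n m) n) ≡ n * (k ^ ((n * m ∸ m) / 2) * t ^ m)
  sum-fixedTilingCount-odd n m 2∤n with parity n
  ... | inj₁ (h , n≡h*2) = ⊥-elim (2∤n (divides h n≡h*2))
  ... | inj₂ (h , refl)  = begin
    sum (applyUpTo F n)
      ≡⟨ sum-applyUpTo-periodic h 1 F (+-comm 1 (h * 2)) (fixedTilingCount-periodic n m) ⟩
    h * (F 0 + F 1) + (F 0 + 0)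
      ≡⟨ cong₂ (λ x y → h * (x + y) + (x + 0)) F0≡C F1≡C ⟩
    h * (C + C) + (C + 0)
      ≡⟨ regroup h C ⟩
    n * C
      ≡⟨ cong (n *_) C≡ ⟩
    n * (k ^ ((n * m ∸ m) / 2) * t ^ m) ∎
    where
    open ≡-Reasoning
    F : ℕ → ℕ
    F = fixedTilingCount n m
    C : ℕ
    C = (k ^ h * t) ^ m
    regroup : ∀ h x → h * (x + x) + (x + 0) ≡ (1 + h * 2) * x
    regroup = solve-∀
    F0≡C : F 0 ≡ C
    F0≡C = cong (_^ m) (trans (*-identityʳ _) (palindromeCount-odd h))
    F1≡C : F 1 ≡ C
    F1≡C = cong (λ x → (x * t) ^ m) (palindromeCount-even h)
    C≡ : C ≡ k ^ ((n * m ∸ m) / 2) * t ^ m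
    C≡ = begin
      (k ^ h * t) ^ m                 ≡⟨ ^-distribʳ-* (k ^ h) t m ⟩
      (k ^ h) ^ m * t ^ m             ≡⟨ cong (_* t ^ m) (^-*-assoc k h m) ⟩
      k ^ (h * m) * t ^ m             ≡⟨ cong (λ e → k ^ e * t ^ m) ([1+h*2]*m∸m/2≡h*m h m) ⟨
      k ^ ((n * m ∸ m) / 2) * t ^ m   ∎

fixedTilings↔ : ∀ n m .{{_ : NonZero n}} {R k} (TD : TileDesigns R k) (fR : T (Subgroup.mem R f)) (a : Fin n) →
                X n m TD fR a ↔ Fin (fixedTilingCount k (t-f TD fR) n m (toℕ a))
fixedTilings↔ n m {R} {k} TD fR a =
  ↔-trans (equivariantRows↔columns (reflectA n a)) (Vec↔Fin^ m (↔-trans (reflectA-equivariants↔ n a)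
    (↔-trans (palindromes↔′ (n ∸ toℕ a) ×-↔ palindromes↔′ (toℕ a)) (↔-sym *↔×))))
  where
  open TileDesigns TD
  open Subgroup R
  open Equivariance FinP._≟_ (λ d → act d f fR)
  φ-involutive : ∀ d → act (act d f fR) f fR ≡ d
  φ-involutive d = trans (act-∙ d f f fR fR has-e) (act-id d has-e)
  palindromes↔′ : ∀ l → Palindromes l ↔ Fin (palindromeCount k (t-f TD fR) l)
  palindromes↔′ = palindromes↔ φ-involutive ↔-refl (filter-tabulate↔ (λ d → act d f fR FinP.≟ d) k id)

mainTheorem7 : (n m : ℕ) .{{_ : NonZero n}} .{{_ : NonZero m}}
    (R : Subgroup) (fR : T (Subgroup.mem R f)) (k : ℕ) (TD : TileDesigns R k)
    (c : Fin n → ℕ) → (∀ a → X n m TD fR a ↔ Fin (c a)) →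
    (2 ∣ n → 2 * sumFin n c ≡ n * (k ^ ((n * m) / 2) + k ^ ((n * m ∸ 2 * m) / 2) * t-f TD fR ^ (2 * m)))
    × (2 ∤ n → sumFin n c ≡ n * (k ^ ((n * m ∸ m) / 2) * t-f TD fR ^ m))
mainTheorem7 n m R fR k TD c X↔c =
  (λ 2∣n → trans (cong (2 *_) sum≡) (sum-fixedTilingCount-even k t n m 2∣n)) ,
  (λ 2∤n → trans sum≡ (sum-fixedTilingCount-odd k t n m 2∤n))
  where
  t : ℕ
  t = t-f TD fR
  c≡ : ∀ a → c a ≡ fixedTilingCount k t n m (toℕ a)
  c≡ a = ↔⇒≡ (↔-trans (↔-sym (X↔c a)) (fixedTilings↔ n m TD fR a))
  sum≡ : sumFin n c ≡ sum (applyUpTo (fixedTilingCount k t n m) n)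
  sum≡ = cong sum (trans (map-tabulate id c) (tabulate≡applyUpTo n c≡))
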